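{- Let $d>1$ be an integer, $\pi\in S_n$, and let $l$ be a $d$-padding of $\pi$. Then $\mathrm{mdev}(\pi)\le \frac{2}{d}\,\mathrm{mdsp}(l)$ and $\mathrm{dev}(\pi)\le \mathrm{dsp}(l)$.
   Context: $[n]=\{1,\dots,n\}$, $S_n$ the permutations of $[n]$; $\mathrm{mdev}(\pi)=\max_i|\pi(i)-i|$, $\mathrm{dev}(\pi)=\sum_i|\pi(i)-i|$. Let $N=(n+1)d-1$. A $d$-padding of $\pi$ is a list $l=(l[1],\dots,l[N])$ whose entries are either the symbol $\bot$ (a gap) or elements of $[n]$, such that the non-gap entries, read left to right, form the sequence $(\pi(1),\dots,\pi(n))$ (so exactly $N-n$ entries are $\bot$). For such $l$, $\mathrm{mdsp}(l)=\max_{j\in[N]:\,l[j]\ne\bot}|j-d\cdot l[j]|$ and $\mathrm{dsp}(l)=\sum_{j\in[N]:\,l[j]\ne\bot}|j-d\cdot l[j]|$. -}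

module Defs where

open import Data.Nat using (ℕ; zero; suc; _+_; _*_; _∸_; _⊔_; ∣_-_∣)
open import Data.Fin using (Fin; toℕ)
open import Data.Fin.Permutation using (Permutation′; _⟨$⟩ʳ_)
open import Data.List using (List; []; _∷_; map; foldr; length; catMaybes; allFin)
open import Data.Nat.ListAction using (sum)
open import Data.Maybe using (Maybe; just; nothing)
open import Data.Product using (_×_)
open import Relation.Binary.PropositionalEquality using (_≡_)

-- Convention: [n] = {1,…,n} is represented by Fin n via i ↦ toℕ i + 1.
-- Displacements |π(i) - i| are invariant under this shift, so we use toℕ directly.

oneLine : ∀ {n} → Permutation′ n → List (Fin n)
oneLine {n} π = map (π ⟨$⟩ʳ_) (allFin n)

devTerms : ∀ {n} → Permutation′ n → List ℕ
devTerms {n} π = map (λ i → ∣ toℕ (π ⟨$⟩ʳ i) - toℕ i ∣) (allFin n)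

maxList : List ℕ → ℕ
maxList = foldr _⊔_ 0

mdev : ∀ {n} → Permutation′ n → ℕ
mdev π = maxList (devTerms π)

dev : ∀ {n} → Permutation′ n → ℕ
dev π = sum (devTerms π)

-- A list entry is either a gap (nothing = ⊥) or an element of [n] (just v,
-- standing for toℕ v + 1).
-- dspTermsFrom d j l : the list of |j' - d·l[j']| over non-gap entries,
-- where the first entry of l sits at (1-based) position j.
dspTermsFrom : ∀ {n} → ℕ → ℕ → List (Maybe (Fin n)) → List ℕ
dspTermsFrom d j [] = []
dspTermsFrom d j (nothing ∷ l) = dspTermsFrom d (suc j) l
dspTermsFrom d j (just v ∷ l) = ∣ j - d * suc (toℕ v) ∣ ∷ dspTermsFrom d (suc j) l

dspTerms : ∀ {n} → ℕ → List (Maybe (Fin n)) → List ℕ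
dspTerms d l = dspTermsFrom d 1 l

mdsp : ∀ {n} → ℕ → List (Maybe (Fin n)) → ℕ
mdsp d l = maxList (dspTerms d l)

dsp : ∀ {n} → ℕ → List (Maybe (Fin n)) → ℕ
dsp d l = sum (dspTerms d l)

IsPadding : ∀ {n} → ℕ → Permutation′ n → List (Maybe (Fin n)) → Set
IsPadding {n} d π l = (length l ≡ suc n * d ∸ 1) × (catMaybes l ≡ oneLine π)

-- Let p₁ < … < pₙ be the positions of the non-gap entries of l and put yₖ = π(k).
-- The triangle inequality gives d·|yₖ − k| ≤ |pₖ − d·yₖ| + |pₖ − d·k|.  Since the
-- positions and the targets d·k are both increasing, the sorted matching k ↦ k
-- minimises the sum and the maximum of |pₖ − d·σ(k)| over all permutations σ
-- (an exchange argument), so after summing or maximising over k the second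
-- term is at most the first.  Hence d·mdev π ≤ 2·mdsp l and d·dev π ≤ 2·dsp l,
-- and the latter gives dev π ≤ dsp l because d ≥ 2.

module Submission where

open import Data.Fin using (Fin; toℕ)
open import Data.Fin.Permutation using (Permutation′; _⟨$⟩ʳ_; inverseʳ)
open import Data.List using (List; []; _∷_; _++_; map; foldr; length; zipWith; catMaybes; allFin)
open import Data.List.Properties using (length-map; length-++)
open import Data.List.Membership.Propositional using (_∈_)
open import Data.List.Membership.Propositional.Properties
  using (∈-∃++; ∈-++⁺ˡ; ∈-allFin; ∈-map⁺)
open import Data.List.Membership.Propositional.Properties.WithK using (unique∧set⇒bag)
open import Data.List.Relation.Binary.BagAndSetEquality using (∼bag⇒↭)
open import Data.List.Relation.Binary.Permutation.Propositional using (_↭_; ↭-sym)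
open import Data.List.Relation.Binary.Permutation.Propositional.Properties
  using (∈-resp-↭; drop-mid; ↭-length)
  renaming (map⁺ to ↭-map⁺)
open import Data.List.Relation.Unary.All as All using (All; []; _∷_)
open import Data.List.Relation.Unary.AllPairs using (AllPairs; []; _∷_)
import Data.List.Relation.Unary.AllPairs.Properties as AllPairs
open import Data.List.Relation.Unary.Any using (here; there)
import Data.List.Relation.Unary.Unique.Propositional.Properties as Unique
open import Data.Maybe using (Maybe; just; nothing)
open import Data.Nat
open import Data.Nat.Properties
open import Data.Nat.Tactic.RingSolver using (solve-∀)
open import Data.Product using (_×_; _,_)
open import Function.Bundles using (Injection; mk⇔)
open import Function.Properties.Inverse using (↔⇒↣)
open import Relation.Binary.PropositionalEquality
open import Relation.Nullary using (yes; no)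
open import Algebra.Definitions {A = ℕ} _≡_ using (Associative; _DistributesOverˡ_)
open import Algebra.Properties.CommutativeSemigroup +-commutativeSemigroup
  using () renaming (interchange to +-interchange)
open import Defs

∣m-n∣+2[m⊓n]≡m+n : ∀ m n → ∣ m - n ∣ + (m ⊓ n + m ⊓ n) ≡ m + n
∣m-n∣+2[m⊓n]≡m+n zero    n       = +-identityʳ n
∣m-n∣+2[m⊓n]≡m+n (suc m) zero    = refl
∣m-n∣+2[m⊓n]≡m+n (suc m) (suc n) = begin
  ∣ m - n ∣ + (suc (m ⊓ n) + suc (m ⊓ n)) ≡⟨ cong (∣ m - n ∣ +_) (cong suc (+-suc (m ⊓ n) (m ⊓ n))) ⟩
  ∣ m - n ∣ + suc (suc (m ⊓ n + m ⊓ n))   ≡⟨ +-suc ∣ m - n ∣ _ ⟩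
  suc (∣ m - n ∣ + suc (m ⊓ n + m ⊓ n))   ≡⟨ cong suc (+-suc ∣ m - n ∣ _) ⟩
  suc (suc (∣ m - n ∣ + (m ⊓ n + m ⊓ n))) ≡⟨ cong (λ k → suc (suc k)) (∣m-n∣+2[m⊓n]≡m+n m n) ⟩
  suc (suc (m + n))                       ≡⟨ cong suc (+-suc m n) ⟨
  suc m + suc n                           ∎
  where open ≡-Reasoning

⊓-supermodular : ∀ {p q x y} → p ≤ q → x ≤ y → p ⊓ y + q ⊓ x ≤ p ⊓ x + q ⊓ y
⊓-supermodular {p} {q} {x} {y} p≤q x≤y with q ≤? x | p ≤? x
... | yes q≤x | _
  rewrite m≤n⇒m⊓n≡m q≤x | m≤n⇒m⊓n≡m (≤-trans q≤x x≤y)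
        | m≤n⇒m⊓n≡m (≤-trans p≤q q≤x) | m≤n⇒m⊓n≡m (≤-trans p≤q (≤-trans q≤x x≤y)) = ≤-refl
... | no q≰x | yes p≤x
  rewrite m≥n⇒m⊓n≡n (≰⇒≥ q≰x) | m≤n⇒m⊓n≡m p≤x | m≤n⇒m⊓n≡m (≤-trans p≤x x≤y)
  = +-monoʳ-≤ p (⊓-glb (≰⇒≥ q≰x) x≤y)
... | no q≰x | no p≰x
  rewrite m≥n⇒m⊓n≡n (≰⇒≥ q≰x) | m≥n⇒m⊓n≡n (≰⇒≥ p≰x)
  = subst (_≤ x + q ⊓ y) (+-comm x (p ⊓ y)) (+-monoʳ-≤ x (⊓-monoˡ-≤ y p≤q))

-- ∣m-n∣ = m + n − 2(m ⊓ n), and ⊓ is supermodular.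
∣-∣-exchange-+ : ∀ {p q x y} → p ≤ q → x ≤ y →
                 ∣ p - x ∣ + ∣ q - y ∣ ≤ ∣ p - y ∣ + ∣ q - x ∣
∣-∣-exchange-+ {p} {q} {x} {y} p≤q x≤y = +-cancelʳ-≤ (A + A) _ _ (begin
  L + (A + A)
    ≡⟨ regroup ∣ p - x ∣ (p ⊓ x) ∣ q - y ∣ (q ⊓ y) ⟩
  (∣ p - x ∣ + (p ⊓ x + p ⊓ x)) + (∣ q - y ∣ + (q ⊓ y + q ⊓ y))
    ≡⟨ cong₂ _+_ (∣m-n∣+2[m⊓n]≡m+n p x) (∣m-n∣+2[m⊓n]≡m+n q y) ⟩
  (p + x) + (q + y)
    ≡⟨ swap p x q y ⟩
  (p + y) + (q + x)
    ≡⟨ cong₂ _+_ (∣m-n∣+2[m⊓n]≡m+n p y) (∣m-n∣+2[m⊓n]≡m+n q x) ⟨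
  (∣ p - y ∣ + (p ⊓ y + p ⊓ y)) + (∣ q - x ∣ + (q ⊓ x + q ⊓ x))
    ≡⟨ regroup ∣ p - y ∣ (p ⊓ y) ∣ q - x ∣ (q ⊓ x) ⟨
  R + (B + B)
    ≤⟨ +-monoʳ-≤ R (+-mono-≤ B≤A B≤A) ⟩
  R + (A + A)
    ∎)
  where
  open ≤-Reasoning
  L = ∣ p - x ∣ + ∣ q - y ∣
  R = ∣ p - y ∣ + ∣ q - x ∣
  A = p ⊓ x + q ⊓ y
  B = p ⊓ y + q ⊓ x
  B≤A : B ≤ A
  B≤A = ⊓-supermodular p≤q x≤y
  regroup : ∀ a m b k → (a + b) + ((m + k) + (m + k)) ≡ (a + (m + m)) + (b + (k + k))
  regroup = solve-∀
  swap : ∀ a b c e → (a + b) + (c + e) ≡ (a + e) + (c + b)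
  swap = solve-∀

∣-∣-exchange-⊔ : ∀ {p q x y} → p ≤ q → x ≤ y →
                 ∣ p - x ∣ ⊔ ∣ q - y ∣ ≤ ∣ p - y ∣ ⊔ ∣ q - x ∣
∣-∣-exchange-⊔ {p} {q} {x} {y} p≤q x≤y = ⊔-lub ∣p-x∣≤ ∣q-y∣≤
  where
  ∣p-x∣≤ : ∣ p - x ∣ ≤ ∣ p - y ∣ ⊔ ∣ q - x ∣
  ∣p-x∣≤ with p ≤? x
  ... | yes p≤x rewrite m≤n⇒∣m-n∣≡n∸m p≤x | m≤n⇒∣m-n∣≡n∸m (≤-trans p≤x x≤y) =
    ≤-trans (∸-monoˡ-≤ p x≤y) (m≤m⊔n _ _)
  ... | no p≰x rewrite m≤n⇒∣n-m∣≡n∸m (≰⇒≥ p≰x) | m≤n⇒∣n-m∣≡n∸m (≤-trans (≰⇒≥ p≰x) p≤q) =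
    ≤-trans (∸-monoˡ-≤ x p≤q) (m≤n⊔m _ _)
  ∣q-y∣≤ : ∣ q - y ∣ ≤ ∣ p - y ∣ ⊔ ∣ q - x ∣
  ∣q-y∣≤ with q ≤? y
  ... | yes q≤y rewrite m≤n⇒∣m-n∣≡n∸m q≤y | m≤n⇒∣m-n∣≡n∸m (≤-trans p≤q q≤y) =
    ≤-trans (∸-monoʳ-≤ y p≤q) (m≤m⊔n _ _)
  ... | no q≰y rewrite m≤n⇒∣n-m∣≡n∸m (≰⇒≥ q≰y) | m≤n⇒∣n-m∣≡n∸m (≤-trans x≤y (≰⇒≥ q≰y)) =
    ≤-trans (∸-monoʳ-≤ q x≤y) (m≤n⊔m _ _)

∣-∣-triangle-via : ∀ p a b → ∣ a - b ∣ ≤ ∣ p - a ∣ + ∣ p - b ∣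
∣-∣-triangle-via p a b = begin
  ∣ a - b ∣             ≤⟨ ∣-∣-triangle a p b ⟩
  ∣ a - p ∣ + ∣ p - b ∣ ≡⟨ cong (_+ ∣ p - b ∣) (∣-∣-comm a p) ⟩
  ∣ p - a ∣ + ∣ p - b ∣ ∎
  where open ≤-Reasoning

positionsFrom : ∀ {A : Set} → ℕ → List (Maybe A) → List ℕ
positionsFrom j []            = []
positionsFrom j (nothing ∷ l) = positionsFrom (suc j) l
positionsFrom j (just _ ∷ l)  = j ∷ positionsFrom (suc j) l

positionsFrom-≥ : ∀ {A : Set} j (l : List (Maybe A)) → All (j ≤_) (positionsFrom j l)
positionsFrom-≥ j []            = []
positionsFrom-≥ j (nothing ∷ l) = All.map <⇒≤ (positionsFrom-≥ (suc j) l)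
positionsFrom-≥ j (just _ ∷ l)  = ≤-refl ∷ All.map <⇒≤ (positionsFrom-≥ (suc j) l)

positionsFrom-sorted : ∀ {A : Set} j (l : List (Maybe A)) → AllPairs _≤_ (positionsFrom j l)
positionsFrom-sorted j []            = []
positionsFrom-sorted j (nothing ∷ l) = positionsFrom-sorted (suc j) l
positionsFrom-sorted j (just _ ∷ l)  =
  All.map <⇒≤ (positionsFrom-≥ (suc j) l) ∷ positionsFrom-sorted (suc j) l

length-positionsFrom : ∀ {A : Set} j (l : List (Maybe A)) → length (positionsFrom j l) ≡ length (catMaybes l)
length-positionsFrom j []            = refl
length-positionsFrom j (nothing ∷ l) = length-positionsFrom (suc j) l
length-positionsFrom j (just _ ∷ l)  = cong suc (length-positionsFrom (suc j) l)

scaled : ℕ → ∀ {n} → Fin n → ℕ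
scaled d v = d * suc (toℕ v)

dspTermsFrom≡zipWith : ∀ {n} d j (l : List (Maybe (Fin n))) →
                       dspTermsFrom d j l ≡ zipWith ∣_-_∣ (positionsFrom j l) (map (scaled d) (catMaybes l))
dspTermsFrom≡zipWith d j []            = refl
dspTermsFrom≡zipWith d j (nothing ∷ l) = dspTermsFrom≡zipWith d (suc j) l
dspTermsFrom≡zipWith d j (just _ ∷ l)  = cong (_ ∷_) (dspTermsFrom≡zipWith d (suc j) l)

map-*-displacements : ∀ d {n} (σ : Fin n → Fin n) (is : List (Fin n)) →
                      map (d *_) (map (λ i → ∣ toℕ (σ i) - toℕ i ∣) is) ≡
                      zipWith ∣_-_∣ (map (scaled d) (map σ is)) (map (scaled d) is)
map-*-displacements d σ []       = refl
map-*-displacements d σ (i ∷ is) =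
  cong₂ _∷_ (*-distribˡ-∣-∣ d (suc (toℕ (σ i))) (suc (toℕ i))) (map-*-displacements d σ is)

map-scaled-allFin-sorted : ∀ d n → AllPairs _≤_ (map (scaled d) (allFin n))
map-scaled-allFin-sorted d n =
  AllPairs.map⁺ (AllPairs.tabulate⁺-< λ i<j → *-monoʳ-≤ d (m≤n⇒m≤1+n i<j))

-- Both lists are duplicate-free and contain every element of Fin n.
oneLine↭allFin : ∀ {n} (π : Permutation′ n) → oneLine π ↭ allFin n
oneLine↭allFin {n} π = ∼bag⇒↭ (unique∧set⇒bag
  (Unique.map⁺ (Injection.injective (↔⇒↣ π)) (Unique.allFin⁺ n))
  (Unique.allFin⁺ n)
  (mk⇔ (λ _ → ∈-allFin _) λ _ → subst (_∈ oneLine π) (inverseʳ π) (∈-map⁺ (π ⟨$⟩ʳ_) (∈-allFin _))))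

-- The sum and the maximum are handled uniformly as folds of _⊕_.
module Aggregate
  (_⊕_ : ℕ → ℕ → ℕ)
  (⊕-mono-≤ : ∀ {a b c e} → a ≤ b → c ≤ e → a ⊕ c ≤ b ⊕ e)
  (⊕-assoc : Associative _⊕_)
  (*-distribˡ-⊕ : _*_ DistributesOverˡ _⊕_)
  (+-⊕-interchange : ∀ a b c e → (a + b) ⊕ (c + e) ≤ (a ⊕ c) + (b ⊕ e))
  (∣-∣-exchange : ∀ {p q x y} → p ≤ q → x ≤ y → ∣ p - x ∣ ⊕ ∣ q - y ∣ ≤ ∣ p - y ∣ ⊕ ∣ q - x ∣)
  where

  total : List ℕ → ℕ
  total = foldr _⊕_ 0

  distance : List ℕ → List ℕ → ℕ
  distance xs ys = total (zipWith ∣_-_∣ xs ys)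

  *-distribˡ-total : ∀ d xs → d * total xs ≡ total (map (d *_) xs)
  *-distribˡ-total d []       = *-zeroʳ d
  *-distribˡ-total d (x ∷ xs) = trans (*-distribˡ-⊕ d x (total xs)) (cong ((d * x) ⊕_) (*-distribˡ-total d xs))

  distance-triangle : ∀ ps as bs → length ps ≡ length as →
                      distance as bs ≤ distance ps as + distance ps bs
  distance-triangle ps       []       bs       _   = z≤n
  distance-triangle ps       (a ∷ as) []       _   = z≤n
  distance-triangle (p ∷ ps) (a ∷ as) (b ∷ bs) len = begin
    ∣ a - b ∣ ⊕ distance as bs
      ≤⟨ ⊕-mono-≤ (∣-∣-triangle-via p a b) (distance-triangle ps as bs (suc-injective len)) ⟩
    (∣ p - a ∣ + ∣ p - b ∣) ⊕ (distance ps as + distance ps bs)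
      ≤⟨ +-⊕-interchange _ _ _ _ ⟩
    (∣ p - a ∣ ⊕ distance ps as) + (∣ p - b ∣ ⊕ distance ps bs) ∎
    where open ≤-Reasoning

  distance-bubble : ∀ {x} as bs ps → AllPairs _≤_ ps → All (x ≤_) as → length as < length ps →
                    distance ps (x ∷ as ++ bs) ≤ distance ps (as ++ x ∷ bs)
  distance-bubble []       bs ps _ _ _ = ≤-refl
  distance-bubble {x} (a ∷ as) bs (p ∷ q ∷ ps) ((p≤q ∷ _) ∷ q∷ps-sorted) (x≤a ∷ x≤as) (s≤s len) = begin
    ∣ p - x ∣ ⊕ (∣ q - a ∣ ⊕ rest) ≡⟨ ⊕-assoc _ _ _ ⟨
    (∣ p - x ∣ ⊕ ∣ q - a ∣) ⊕ rest ≤⟨ ⊕-mono-≤ (∣-∣-exchange p≤q x≤a) ≤-refl ⟩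
    (∣ p - a ∣ ⊕ ∣ q - x ∣) ⊕ rest ≡⟨ ⊕-assoc _ _ _ ⟩
    ∣ p - a ∣ ⊕ (∣ q - x ∣ ⊕ rest) ≤⟨ ⊕-mono-≤ ≤-refl (distance-bubble as bs (q ∷ ps) q∷ps-sorted x≤as len) ⟩
    ∣ p - a ∣ ⊕ distance (q ∷ ps) (as ++ x ∷ bs) ∎
    where open ≤-Reasoning
          rest = distance ps (as ++ bs)
  distance-bubble (a ∷ as) bs (p ∷ []) _ _ (s≤s ())

  -- Bring the least element x of xs to the front of ys by exchanges, then recurse.
  distance-sorted-minimal : ∀ {ps xs ys} → AllPairs _≤_ ps → AllPairs _≤_ xs → ys ↭ xs →
                            length ps ≡ length xs → distance ps xs ≤ distance ps ys
  distance-sorted-minimal {[]}     {[]}     _ _ _ _ = z≤n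
  distance-sorted-minimal {p ∷ ps} {x ∷ xs} {ys} p∷ps-sorted@(_ ∷ ps-sorted) (x≤xs ∷ xs-sorted) ys↭ len
    with ∈-∃++ (∈-resp-↭ (↭-sym ys↭) (here refl))
  ... | as , bs , refl = begin
    ∣ p - x ∣ ⊕ distance ps xs
      ≤⟨ ⊕-mono-≤ ≤-refl (distance-sorted-minimal ps-sorted xs-sorted (drop-mid as [] ys↭) (suc-injective len)) ⟩
    ∣ p - x ∣ ⊕ distance ps (as ++ bs)
      ≤⟨ distance-bubble as bs (p ∷ ps) p∷ps-sorted x≤as as<ps ⟩
    distance (p ∷ ps) (as ++ x ∷ bs) ∎
    where
    open ≤-Reasoning
    x≤as : All (x ≤_) as
    x≤as = All.tabulate λ a∈as → lower-bound (∈-resp-↭ ys↭ (∈-++⁺ˡ a∈as))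
      where
      lower-bound : ∀ {a} → a ∈ x ∷ xs → x ≤ a
      lower-bound (here refl) = ≤-refl
      lower-bound (there a∈xs) = All.lookup x≤xs a∈xs
    as<ps : length as < length (p ∷ ps)
    as<ps = begin-strict
      length as                    <⟨ m<m+n (length as) z<s ⟩
      length as + length (x ∷ bs)  ≡⟨ length-++ as ⟨
      length (as ++ x ∷ bs)        ≡⟨ ↭-length ys↭ ⟩
      length (x ∷ xs)              ≡⟨ len ⟨
      length (p ∷ ps)              ∎

  distance-bound : ∀ {ps xs ys} → AllPairs _≤_ ps → AllPairs _≤_ xs → ys ↭ xs →
                   length ps ≡ length ys → distance ys xs ≤ 2 * distance ps ys
  distance-bound {ps} {xs} {ys} ps-sorted xs-sorted ys↭ len = begin
    distance ys xs                        ≤⟨ distance-triangle ps ys xs len ⟩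
    distance ps ys + distance ps xs       ≤⟨ +-monoʳ-≤ (distance ps ys) xs-optimal ⟩
    distance ps ys + distance ps ys       ≡⟨ cong (distance ps ys +_) (+-identityʳ (distance ps ys)) ⟨
    2 * distance ps ys                    ∎
    where
    open ≤-Reasoning
    xs-optimal : distance ps xs ≤ distance ps ys
    xs-optimal = distance-sorted-minimal ps-sorted xs-sorted ys↭ (trans len (↭-length ys↭))

  padding-bound : ∀ d {n} (π : Permutation′ n) (l : List (Maybe (Fin n))) → catMaybes l ≡ oneLine π →
                  d * total (devTerms π) ≤ 2 * total (dspTerms d l)
  padding-bound d {n} π l catMaybes≡ = begin
    d * total (devTerms π)
      ≡⟨ *-distribˡ-total d (devTerms π) ⟩
    total (map (d *_) (devTerms π))
      ≡⟨ cong total (map-*-displacements d (π ⟨$⟩ʳ_) (allFin n)) ⟩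
    distance ys xs
      ≤⟨ distance-bound (positionsFrom-sorted 1 l) (map-scaled-allFin-sorted d n) ys↭xs len ⟩
    2 * distance ps ys
      ≡⟨ cong (λ vs → 2 * distance ps (map (scaled d) vs)) catMaybes≡ ⟨
    2 * distance ps (map (scaled d) (catMaybes l))
      ≡⟨ cong (λ ts → 2 * total ts) (dspTermsFrom≡zipWith d 1 l) ⟨
    2 * total (dspTerms d l) ∎
    where
    open ≤-Reasoning
    ps = positionsFrom 1 l
    ys = map (scaled d) (oneLine π)
    xs = map (scaled d) (allFin n)
    ys↭xs : ys ↭ xs
    ys↭xs = ↭-map⁺ (scaled d) (oneLine↭allFin π)
    len : length ps ≡ length ys
    len = trans (length-positionsFrom 1 l) (trans (cong length catMaybes≡) (sym (length-map (scaled d) (oneLine π))))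

⊔-+-interchange : ∀ a b c e → (a + b) ⊔ (c + e) ≤ (a ⊔ c) + (b ⊔ e)
⊔-+-interchange a b c e =
  ⊔-lub (+-mono-≤ (m≤m⊔n a c) (m≤m⊔n b e)) (+-mono-≤ (m≤n⊔m a c) (m≤n⊔m b e))

module Sum = Aggregate _+_ +-mono-≤ +-assoc *-distribˡ-+ (λ a b c e → ≤-reflexive (+-interchange a b c e)) ∣-∣-exchange-+
module Max = Aggregate _⊔_ ⊔-mono-≤ ⊔-assoc *-distribˡ-⊔ ⊔-+-interchange ∣-∣-exchange-⊔

lemma2p6 : (d n : ℕ) → 1 < d → (π : Permutation′ n) → (l : List (Maybe (Fin n))) →
    IsPadding d π l →
    (d * mdev π ≤ 2 * mdsp d l) × (dev π ≤ dsp d l)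
lemma2p6 d n 1<d π l (_ , catMaybes≡) = Max.padding-bound d π l catMaybes≡ , dev≤dsp
  where
  dev≤dsp : dev π ≤ dsp d l
  dev≤dsp = *-cancelˡ-≤ 2 (≤-trans (*-monoˡ-≤ (dev π) 1<d) (Sum.padding-bound d π l catMaybes≡))
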